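{- Let $m\geq 0$ be an integer. Let $G$ be a connected graph of order $n$, let $u\in V(G)$ and let $Y\subseteq V(G)\setminus\{u\}$. If $\delta(G)\geq 2\sqrt{n}+m+|Y|$, then there exists a set $X\subseteq N_{G}(u)\setminus Y$ with $|X|=m$ such that $G-X$ is connected.
   Context: All graphs are finite and simple. $\delta(G)$ is the minimum degree of $G$ and $N_G(u)$ the neighborhood of $u$ in $G$. -}

module Defs where

open import Data.Nat using (ℕ; _+_; _*_; _∸_; _≤_)
open import Data.Bool using (Bool; true; false)
open import Data.Fin using (Fin)
open import Data.Fin.Subset using (Subset; _∈_; ∁; ⊤; ∣_∣; _─_)
open import Data.Vec using (tabulate)
open import Data.Product using (_×_)
open import Relation.Binary.PropositionalEquality using (_≡_)

record Graph (n : ℕ) : Set where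
  field
    adj   : Fin n → Fin n → Bool
    sym   : ∀ u v → adj u v ≡ adj v u
    irrefl : ∀ u → adj u u ≡ false

open Graph public

N : ∀ {n} → Graph n → Fin n → Subset n
N G u = tabulate (adj G u)

deg : ∀ {n} → Graph n → Fin n → ℕ
deg G u = ∣ N G u ∣

MinDegAtLeast : ∀ {n} → Graph n → ℕ → Set
MinDegAtLeast G k = ∀ v → k ≤ deg G v

data Walk {n} (G : Graph n) (S : Subset n) : Fin n → Fin n → Set where
  here : ∀ {v} → v ∈ S → Walk G S v v
  step : ∀ {v w x} → v ∈ S → adj G v w ≡ true → Walk G S w x → Walk G S v x

ConnectedOn : ∀ {n} → Graph n → Subset n → Set
ConnectedOn G S = ∀ v w → v ∈ S → w ∈ S → Walk G S v w

Connected : ∀ {n} → Graph n → Set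
Connected G = ConnectedOn G ⊤

ConnectedMinus : ∀ {n} → Graph n → Subset n → Set
ConnectedMinus G X = ConnectedOn G (∁ X)

-- k ≥ 2√n + c  (over the reals), expressed exactly in ℕ:
-- c ≤ k and 4n ≤ (k - c)²  (valid since both sides of k - c ≥ 2√n are ≥ 0).
AtLeastTwoSqrtPlus : ℕ → ℕ → ℕ → Set
AtLeastTwoSqrtPlus k n c = (c ≤ k) × (4 * n ≤ (k ∸ c) * (k ∸ c))

MinDegAtLeastTwoSqrtPlus : ∀ {n} → Graph n → ℕ → Set
MinDegAtLeastTwoSqrtPlus {n} G c = ∀ v → AtLeastTwoSqrtPlus (deg G v) n c

{-# OPTIONS --safe #-}
module Submission where

-- Delete the m neighbours one at a time, keeping every degree inside the remaining vertex set V at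
-- least k + |Y|, where n < k². To delete one, let S = N(u) ∩ V ─ Y and, for s ∈ S, let U_s be the
-- part of V - s not reachable from u. If no deletion kept V connected, every U_s would be nonempty;
-- a vertex of U_s has its closed neighbourhood inside U_s ∪ {s}, so |U_s| ≥ k. The U_s are pairwise
-- disjoint, since a walk in V from a common vertex to u must enter s or t, and each of these lies
-- in the other's component. As also |S| ≥ k, we would get k² ≤ |S| k ≤ n.

open import Defs hiding (sym)
open import Data.Nat using (ℕ; zero; suc; _+_; _*_; _∸_; _≤_; _<_; z≤n; s≤s; s≤s⁻¹)
open import Data.Nat.Properties hiding (_≟_; suc-injective)
open import Data.Bool using (true)
open import Data.Bool.Properties using () renaming (_≟_ to _≟ᵇ_)
open import Data.Fin using (Fin; zero; suc; _≟_)
open import Data.Fin.Properties using (any?; suc-injective)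
open import Data.Fin.Subset
open import Data.Fin.Subset.Properties
open import Data.Vec using ([]; _∷_; here; there)
open import Data.Vec.Properties using (lookup∘tabulate; []=⇒lookup)
open import Data.List using (allFin)
open import Data.List.Extrema ≤-totalOrder using (argmin; f[argmin]≤f[xs])
open import Data.List.Relation.Unary.All using () renaming (lookup to All-lookup)
open import Data.List.Membership.Propositional.Properties using (∈-allFin)
open import Data.Product using (Σ; ∃; _×_; _,_; proj₁; proj₂)
open import Data.Sum using (_⊎_; inj₁; inj₂)
open import Data.Empty using (⊥-elim)
open import Function using (_∘_)
open import Relation.Nullary using (¬_; Dec; yes; no)
open import Relation.Nullary.Decidable using (_×-dec_; decidable-stable)
open import Relation.Binary.PropositionalEquality

x∈p─q⇒x∉q : ∀ {n} {x : Fin n} (p q : Subset n) → x ∈ p ─ q → x ∉ q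
x∈p─q⇒x∉q (_      ∷ p) (inside  ∷ q) ()        here
x∈p─q⇒x∉q (inside ∷ p) (outside ∷ q) here      ()
x∈p─q⇒x∉q (_      ∷ p) (_       ∷ q) (there x∈) (there x∈q) = x∈p─q⇒x∉q p q x∈ x∈q

x∈p─q⁻ : ∀ {n} {x : Fin n} {p q : Subset n} → x ∈ p ─ q → x ∈ p × x ∉ q
x∈p─q⁻ {p = p} {q} x∈ = p─q⊆p p q x∈ , x∈p─q⇒x∉q p q x∈

∣p∪q∣≤∣p∣+∣q∣ : ∀ {n} (p q : Subset n) → ∣ p ∪ q ∣ ≤ ∣ p ∣ + ∣ q ∣
∣p∪q∣≤∣p∣+∣q∣ []            []            = z≤n
∣p∪q∣≤∣p∣+∣q∣ (outside ∷ p) (outside ∷ q) = ∣p∪q∣≤∣p∣+∣q∣ p q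
∣p∪q∣≤∣p∣+∣q∣ (outside ∷ p) (inside  ∷ q) rewrite +-suc ∣ p ∣ ∣ q ∣ = s≤s (∣p∪q∣≤∣p∣+∣q∣ p q)
∣p∪q∣≤∣p∣+∣q∣ (inside  ∷ p) (outside ∷ q) = s≤s (∣p∪q∣≤∣p∣+∣q∣ p q)
∣p∪q∣≤∣p∣+∣q∣ (inside  ∷ p) (inside  ∷ q) rewrite +-suc ∣ p ∣ ∣ q ∣ =
  s≤s (m≤n⇒m≤1+n (∣p∪q∣≤∣p∣+∣q∣ p q))

disjoint⇒∣p∣+∣q∣≤∣p∪q∣ : ∀ {n} (p q : Subset n) → (∀ {x} → x ∈ p → x ∉ q) → ∣ p ∣ + ∣ q ∣ ≤ ∣ p ∪ q ∣
disjoint⇒∣p∣+∣q∣≤∣p∪q∣ []            []            _ = z≤n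
disjoint⇒∣p∣+∣q∣≤∣p∪q∣ (outside ∷ p) (outside ∷ q) d = disjoint⇒∣p∣+∣q∣≤∣p∪q∣ p q (λ x∈p x∈q → d (there x∈p) (there x∈q))
disjoint⇒∣p∣+∣q∣≤∣p∪q∣ (outside ∷ p) (inside  ∷ q) d rewrite +-suc ∣ p ∣ ∣ q ∣ =
  s≤s (disjoint⇒∣p∣+∣q∣≤∣p∪q∣ p q (λ x∈p x∈q → d (there x∈p) (there x∈q)))
disjoint⇒∣p∣+∣q∣≤∣p∪q∣ (inside  ∷ p) (outside ∷ q) d =
  s≤s (disjoint⇒∣p∣+∣q∣≤∣p∪q∣ p q (λ x∈p x∈q → d (there x∈p) (there x∈q)))
disjoint⇒∣p∣+∣q∣≤∣p∪q∣ (inside  ∷ p) (inside  ∷ q) d = ⊥-elim (d here here)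

∣⁅x⁆∪p∣≤1+∣p∣ : ∀ {n} (x : Fin n) (p : Subset n) → ∣ ⁅ x ⁆ ∪ p ∣ ≤ suc ∣ p ∣
∣⁅x⁆∪p∣≤1+∣p∣ x p = ≤-trans (∣p∪q∣≤∣p∣+∣q∣ ⁅ x ⁆ p) (≤-reflexive (cong (_+ ∣ p ∣) (∣⁅x⁆∣≡1 x)))

x∉p⇒∣⁅x⁆∪p∣≡1+∣p∣ : ∀ {n} {x : Fin n} {p : Subset n} → x ∉ p → ∣ ⁅ x ⁆ ∪ p ∣ ≡ suc ∣ p ∣
x∉p⇒∣⁅x⁆∪p∣≡1+∣p∣ {x = x} {p} x∉p = ≤-antisym (∣⁅x⁆∪p∣≤1+∣p∣ x p) (begin
  suc ∣ p ∣        ≡⟨ cong (_+ ∣ p ∣) (∣⁅x⁆∣≡1 x) ⟨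
  ∣ ⁅ x ⁆ ∣ + ∣ p ∣ ≤⟨ disjoint⇒∣p∣+∣q∣≤∣p∪q∣ ⁅ x ⁆ p (λ y∈⁅x⁆ → subst (_∉ p) (sym (x∈⁅y⁆⇒x≡y x y∈⁅x⁆)) x∉p) ⟩
  ∣ ⁅ x ⁆ ∪ p ∣    ∎)
  where open ≤-Reasoning

∣p∣≤1+∣p-x∣ : ∀ {n} (p : Subset n) (x : Fin n) → ∣ p ∣ ≤ suc ∣ p - x ∣
∣p∣≤1+∣p-x∣ p x = ≤-trans (p⊆q⇒∣p∣≤∣q∣ p⊆⁅x⁆∪[p-x]) (∣⁅x⁆∪p∣≤1+∣p∣ x (p - x))
  where
  p⊆⁅x⁆∪[p-x] : p ⊆ ⁅ x ⁆ ∪ (p - x)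
  p⊆⁅x⁆∪[p-x] {y} y∈p with y ≟ x
  ... | yes refl = x∈p∪q⁺ (inj₁ (x∈⁅x⁆ y))
  ... | no  y≢x  = x∈p∪q⁺ (inj₂ (x∈p∧x≢y⇒x∈p-y y∈p y≢x))

∣p∩q∣≤1+∣p∩[q-x]∣ : ∀ {n} (p q : Subset n) (x : Fin n) → ∣ p ∩ q ∣ ≤ suc ∣ p ∩ (q - x) ∣
∣p∩q∣≤1+∣p∩[q-x]∣ p q x = ≤-trans (∣p∣≤1+∣p-x∣ (p ∩ q) x) (s≤s (p⊆q⇒∣p∣≤∣q∣ [p∩q]-x⊆p∩[q-x]))
  where
  [p∩q]-x⊆p∩[q-x] : p ∩ q - x ⊆ p ∩ (q - x)
  [p∩q]-x⊆p∩[q-x] y∈ with x∈p─q⁻ y∈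
  ... | y∈p∩q , y∉⁅x⁆ with x∈p∩q⁻ p q y∈p∩q
  ...   | y∈p , y∈q = x∈p∩q⁺ (y∈p , x∈p∧x∉q⇒x∈p─q y∈q y∉⁅x⁆)

∣p∣≤∣p─q∣+∣q∣ : ∀ {n} (p q : Subset n) → ∣ p ∣ ≤ ∣ p ─ q ∣ + ∣ q ∣
∣p∣≤∣p─q∣+∣q∣ p q = ≤-trans (p⊆q⇒∣p∣≤∣q∣ p⊆[p─q]∪q) (∣p∪q∣≤∣p∣+∣q∣ (p ─ q) q)
  where
  p⊆[p─q]∪q : p ⊆ (p ─ q) ∪ q
  p⊆[p─q]∪q {x} x∈p with x ∈? q
  ... | yes x∈q = x∈p∪q⁺ (inj₂ x∈q)
  ... | no  x∉q = x∈p∪q⁺ (inj₁ (x∈p∧x∉q⇒x∈p─q x∈p x∉q))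

p⊈q⇒Nonempty[p─q] : ∀ {n} {p q : Subset n} → ¬ p ⊆ q → Nonempty (p ─ q)
p⊈q⇒Nonempty[p─q] {p = p} {q} p⊈q with nonempty? (p ─ q)
... | yes p─q≢∅ = p─q≢∅
... | no  p─q≡∅ = ⊥-elim (p⊈q λ {x} x∈p →
  decidable-stable (x ∈? q) λ x∉q → p─q≡∅ (x , x∈p∧x∉q⇒x∈p─q x∈p x∉q))

⊤─p≡∁p : ∀ {n} (p : Subset n) → ⊤ ─ p ≡ ∁ p
⊤─p≡∁p []            = refl
⊤─p≡∁p (inside  ∷ p) = cong (outside ∷_) (⊤─p≡∁p p)
⊤─p≡∁p (outside ∷ p) = cong (inside ∷_) (⊤─p≡∁p p)

⋃-over : ∀ {m n} → Subset m → (Fin m → Subset n) → Subset n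
⋃-over []            C = ⊥
⋃-over (outside ∷ S) C = ⋃-over S (C ∘ suc)
⋃-over (inside  ∷ S) C = C zero ∪ ⋃-over S (C ∘ suc)

∈⋃-over⁻ : ∀ {m n} {x : Fin n} (S : Subset m) (C : Fin m → Subset n) →
           x ∈ ⋃-over S C → ∃ λ s → s ∈ S × x ∈ C s
∈⋃-over⁻ [] C x∈ = ⊥-elim (∉⊥ x∈)
∈⋃-over⁻ (outside ∷ S) C x∈ with ∈⋃-over⁻ S (C ∘ suc) x∈
... | s , s∈S , x∈Cs = suc s , there s∈S , x∈Cs
∈⋃-over⁻ (inside ∷ S) C x∈ with x∈p∪q⁻ (C zero) _ x∈
... | inj₁ x∈C₀ = zero , here , x∈C₀
... | inj₂ x∈⋃ with ∈⋃-over⁻ S (C ∘ suc) x∈⋃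
...   | s , s∈S , x∈Cs = suc s , there s∈S , x∈Cs

PairwiseDisjointOn : ∀ {m n} → Subset m → (Fin m → Subset n) → Set
PairwiseDisjointOn S C = ∀ {s t x} → s ∈ S → t ∈ S → x ∈ C s → x ∈ C t → s ≡ t

pairwiseDisjointOn-∷⁻ : ∀ {m n b} {S : Subset m} {C : Fin (suc m) → Subset n} →
                        PairwiseDisjointOn (b ∷ S) C → PairwiseDisjointOn S (C ∘ suc)
pairwiseDisjointOn-∷⁻ disjoint s∈ t∈ x∈ x∈′ = suc-injective (disjoint (there s∈) (there t∈) x∈ x∈′)

∣S∣*k≤∣⋃-over∣ : ∀ {m n k} (S : Subset m) (C : Fin m → Subset n) → PairwiseDisjointOn S C →
                 (∀ {s} → s ∈ S → k ≤ ∣ C s ∣) → ∣ S ∣ * k ≤ ∣ ⋃-over S C ∣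
∣S∣*k≤∣⋃-over∣ [] C _ _ = z≤n
∣S∣*k≤∣⋃-over∣ (outside ∷ S) C disjoint large =
  ∣S∣*k≤∣⋃-over∣ S (C ∘ suc) (pairwiseDisjointOn-∷⁻ disjoint) (large ∘ there)
∣S∣*k≤∣⋃-over∣ {k = k} (inside ∷ S) C disjoint large = begin
  k + ∣ S ∣ * k                       ≤⟨ +-mono-≤ (large here) (∣S∣*k≤∣⋃-over∣ S (C ∘ suc) (pairwiseDisjointOn-∷⁻ disjoint) (large ∘ there)) ⟩
  ∣ C zero ∣ + ∣ ⋃-over S (C ∘ suc) ∣ ≤⟨ disjoint⇒∣p∣+∣q∣≤∣p∪q∣ (C zero) _ C₀∩rest≡∅ ⟩
  ∣ C zero ∪ ⋃-over S (C ∘ suc) ∣     ∎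
  where
  open ≤-Reasoning
  C₀∩rest≡∅ : ∀ {x} → x ∈ C zero → x ∉ ⋃-over S (C ∘ suc)
  C₀∩rest≡∅ x∈C₀ x∈⋃ with ∈⋃-over⁻ S (C ∘ suc) x∈⋃
  ... | s , s∈S , x∈Cs with disjoint here (there s∈S) x∈C₀ x∈Cs
  ...   | ()

module _ {n : ℕ} (G : Graph n) where

  adj-sym : ∀ {v w} → adj G v w ≡ true → adj G w v ≡ true
  adj-sym {v} {w} vw = trans (Graph.sym G w v) vw

  adj⇒≢ : ∀ {v w} → adj G v w ≡ true → v ≢ w
  adj⇒≢ {v} vv refl with trans (sym vv) (irrefl G v)
  ... | ()

  ∈N⇒adj : ∀ {u v} → v ∈ N G u → adj G u v ≡ true
  ∈N⇒adj {u} {v} v∈ = trans (sym (lookup∘tabulate (adj G u) v)) ([]=⇒lookup v∈)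

  x∉N[x] : ∀ x → x ∉ N G x
  x∉N[x] x x∈ = adj⇒≢ (∈N⇒adj x∈) refl

  walk-start : ∀ {W v w} → Walk G W v w → v ∈ W
  walk-start (here v∈)     = v∈
  walk-start (step v∈ _ _) = v∈

  _++ʷ_ : ∀ {W v w x} → Walk G W v w → Walk G W w x → Walk G W v x
  here _      ++ʷ q = q
  step v∈ e p ++ʷ q = step v∈ e (p ++ʷ q)

  extend : ∀ {W v w x} → Walk G W v w → adj G w x ≡ true → x ∈ W → Walk G W v x
  extend (here w∈)     e x∈ = step w∈ e (here x∈)
  extend (step v∈ e p) f x∈ = step v∈ e (extend p f x∈)

  reverse : ∀ {W v w} → Walk G W v w → Walk G W w v
  reverse (here v∈)     = here v∈
  reverse (step v∈ e p) = extend (reverse p) (adj-sym e) v∈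

  Closed : Subset n → Subset n → Set
  Closed W R = ∀ {v w} → v ∈ R → w ∈ W → adj G v w ≡ true → w ∈ R

  -- Defined also for u ∉ W (then it may be empty), so that a component of V - s exists for every s.
  record Component (W : Subset n) (u : Fin n) : Set where
    field
      carrier   : Subset n
      reachable : ∀ {v} → v ∈ carrier → Walk G W u v
      closed    : Closed W carrier
      source    : u ∈ W → u ∈ carrier

  open Component

  module _ (W : Subset n) (u : Fin n) where

    Exit : Subset n → Set
    Exit R = ∃ λ w → w ∈ W ─ R × ∃ λ v → v ∈ R × adj G v w ≡ true

    exit? : (R : Subset n) → Dec (Exit R)
    exit? R = any? λ w → (w ∈? W ─ R) ×-dec any? λ v → (v ∈? R) ×-dec (adj G v w ≟ᵇ true)

    -- Each round adds a vertex, so the fuel never runs out.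
    grow : (fuel : ℕ) (R : Subset n) → n < fuel + ∣ R ∣ → (∀ {v} → v ∈ R → Walk G W u v) →
           (u ∈ W → u ∈ R) → Component W u
    grow zero R n<∣R∣ _ _ = ⊥-elim (<⇒≱ n<∣R∣ (∣p∣≤n R))
    grow (suc fuel) R n<fuel+∣R∣ reach src with exit? R
    ... | no no-exit = record
      { carrier   = R
      ; reachable = reach
      ; closed    = λ {v} {w} v∈R w∈W vw →
          decidable-stable (w ∈? R) λ w∉R → no-exit (w , x∈p∧x∉q⇒x∈p─q w∈W w∉R , v , v∈R , vw)
      ; source    = src
      }
    ... | yes (w , w∈W─R , v , v∈R , vw) with x∈p─q⁻ w∈W─R
    ...   | w∈W , w∉R = grow fuel (⁅ w ⁆ ∪ R) bound reach′ (x∈p∪q⁺ ∘ inj₂ ∘ src)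
      where
      bound : n < fuel + ∣ ⁅ w ⁆ ∪ R ∣
      bound = subst (n <_) (trans (sym (+-suc fuel ∣ R ∣)) (cong (fuel +_) (sym (x∉p⇒∣⁅x⁆∪p∣≡1+∣p∣ w∉R))))
                    n<fuel+∣R∣
      reach′ : ∀ {x} → x ∈ ⁅ w ⁆ ∪ R → Walk G W u x
      reach′ x∈ with x∈p∪q⁻ ⁅ w ⁆ R x∈
      ... | inj₁ x∈⁅w⁆ rewrite x∈⁅y⁆⇒x≡y w x∈⁅w⁆ = extend (reach v∈R) vw w∈W
      ... | inj₂ x∈R = reach x∈R

  component : (W : Subset n) (u : Fin n) → Component W u
  component W u = grow W u (suc n) (W ∩ ⁅ u ⁆) (s≤s (m≤m+n n _)) start (λ u∈W → x∈p∩q⁺ (u∈W , x∈⁅x⁆ u))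
    where
    start : ∀ {v} → v ∈ W ∩ ⁅ u ⁆ → Walk G W u v
    start v∈ with x∈p∩q⁻ W ⁅ u ⁆ v∈
    ... | v∈W , v∈⁅u⁆ rewrite x∈⁅y⁆⇒x≡y u v∈⁅u⁆ = here v∈W

  spanning-component⇒connected : ∀ {W u} (C : Component W u) → W ⊆ carrier C → ConnectedOn G W
  spanning-component⇒connected C W⊆C v w v∈ w∈ = reverse (reachable C (W⊆C v∈)) ++ʷ reachable C (W⊆C w∈)

  no-edge-into-closed : ∀ {W R a x} → Closed W R → a ∈ W ─ R → x ∈ R → ¬ adj G x a ≡ true
  no-edge-into-closed closed a∈ x∈R xa with x∈p─q⁻ a∈
  ... | a∈W , a∉R = a∉R (closed x∈R a∈W xa)

  outside-step : ∀ {V s R a w} → Closed (V - s) R → a ∈ V - s ─ R → w ∈ V → adj G a w ≡ true →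
                 w ≡ s ⊎ w ∈ V - s ─ R
  outside-step {s = s} {R} {w = w} closed a∈ w∈V aw with w ≟ s
  ... | yes w≡s = inj₁ w≡s
  ... | no  w≢s with w ∈? R
  ...   | yes w∈R = ⊥-elim (no-edge-into-closed closed a∈ w∈R (adj-sym aw))
  ...   | no  w∉R = inj₂ (x∈p∧x∉q⇒x∈p─q (x∈p∧x≢y⇒x∈p-y w∈V w≢s) w∉R)

  degree≤∣outside∣ : ∀ {V s R c} → Closed (V - s) R → c ∈ V - s ─ R → ∣ N G c ∩ V ∣ ≤ ∣ V - s ─ R ∣
  degree≤∣outside∣ {V} {s} {R} {c} closed c∈ = s≤s⁻¹ (begin
    suc ∣ N G c ∩ V ∣       ≡⟨ x∉p⇒∣⁅x⁆∪p∣≡1+∣p∣ (x∉N[x] c ∘ proj₁ ∘ x∈p∩q⁻ (N G c) V) ⟨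
    ∣ ⁅ c ⁆ ∪ N G c ∩ V ∣    ≤⟨ p⊆q⇒∣p∣≤∣q∣ closed-nbhd⊆ ⟩
    ∣ ⁅ s ⁆ ∪ (V - s ─ R) ∣ ≤⟨ ∣⁅x⁆∪p∣≤1+∣p∣ s (V - s ─ R) ⟩
    suc ∣ V - s ─ R ∣       ∎)
    where
    open ≤-Reasoning
    closed-nbhd⊆ : ⁅ c ⁆ ∪ N G c ∩ V ⊆ ⁅ s ⁆ ∪ (V - s ─ R)
    closed-nbhd⊆ x∈ with x∈p∪q⁻ ⁅ c ⁆ _ x∈
    ... | inj₁ x∈⁅c⁆ rewrite x∈⁅y⁆⇒x≡y c x∈⁅c⁆ = x∈p∪q⁺ (inj₂ c∈)
    ... | inj₂ x∈N∩V with x∈p∩q⁻ (N G c) V x∈N∩V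
    ...   | x∈N , x∈V with outside-step closed c∈ x∈V (∈N⇒adj x∈N)
    ...     | inj₁ refl  = x∈p∪q⁺ (inj₁ (x∈⁅x⁆ s))
    ...     | inj₂ x∈out = x∈p∪q⁺ (inj₂ x∈out)

  walk-from-common-outside-∉ : ∀ {V s t Rs Rt a b} → Closed (V - s) Rs → Closed (V - t) Rt →
    t ∈ Rs → s ∈ Rt → Walk G V a b → a ∈ V - s ─ Rs → a ∈ V - t ─ Rt → b ∉ Rs
  walk-from-common-outside-∉ _ _ _ _ (here _) a∈s _ = x∈p─q⇒x∉q _ _ a∈s
  walk-from-common-outside-∉ Cs Ct t∈Rs s∈Rt (step _ aw p) a∈s a∈t
    with outside-step Cs a∈s (walk-start p) aw | outside-step Ct a∈t (walk-start p) aw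
  ... | inj₁ refl | _         = ⊥-elim (no-edge-into-closed Ct a∈t s∈Rt (adj-sym aw))
  ... | inj₂ _    | inj₁ refl = ⊥-elim (no-edge-into-closed Cs a∈s t∈Rs (adj-sym aw))
  ... | inj₂ w∈s  | inj₂ w∈t  = walk-from-common-outside-∉ Cs Ct t∈Rs s∈Rt p w∈s w∈t

  module _ {V : Subset n} {u : Fin n} (V-connected : ConnectedOn G V) (u∈V : u ∈ V) where

    reached : Fin n → Subset n
    reached s = carrier (component (V - s) u)

    unreached : Fin n → Subset n
    unreached s = V - s ─ reached s

    reached-closed : ∀ {s} → Closed (V - s) (reached s)
    reached-closed {s} = closed (component (V - s) u)

    u∈reached : ∀ {s} → s ∈ N G u → u ∈ reached s
    u∈reached {s} s∈N = source (component (V - s) u) (x∈p∧x≢y⇒x∈p-y u∈V (adj⇒≢ (∈N⇒adj s∈N)))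

    neighbour∈reached : ∀ {s t} → s ∈ N G u → t ∈ N G u ∩ V → t ≢ s → t ∈ reached s
    neighbour∈reached s∈N t∈ t≢s with x∈p∩q⁻ (N G u) V t∈
    ... | t∈N , t∈V = reached-closed (u∈reached s∈N) (x∈p∧x≢y⇒x∈p-y t∈V t≢s) (∈N⇒adj t∈N)

    unreached⊆V : ∀ {s} → unreached s ⊆ V
    unreached⊆V {s} = p─q⊆p V ⁅ s ⁆ ∘ p─q⊆p (V - s) (reached s)

    unreached-disjoint : PairwiseDisjointOn (N G u ∩ V) unreached
    unreached-disjoint {s} {t} {a} s∈ t∈ a∈s a∈t with s ≟ t
    ... | yes s≡t = s≡t
    ... | no  s≢t = ⊥-elim (walk-from-common-outside-∉ reached-closed reached-closed
          (neighbour∈reached s∈N t∈ (s≢t ∘ sym)) (neighbour∈reached t∈N s∈ s≢t)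
          (V-connected a u (unreached⊆V a∈s) u∈V) a∈s a∈t (u∈reached s∈N))
      where
      s∈N = proj₁ (x∈p∩q⁻ (N G u) V s∈)
      t∈N = proj₁ (x∈p∩q⁻ (N G u) V t∈)

    deletable-neighbour : ∀ {Y k} → n < k * k → (∀ {v} → v ∈ V → k + ∣ Y ∣ ≤ ∣ N G v ∩ V ∣) →
                          ∃ λ s → s ∈ N G u ∩ V ─ Y × ConnectedOn G (V - s)
    deletable-neighbour {Y} {k} n<k*k deg≥ with any? (λ s → (s ∈? N G u ∩ V ─ Y) ×-dec (V - s ⊆? reached s))
    ... | yes (s , s∈S , V-s⊆reached) =
          s , s∈S , spanning-component⇒connected (component (V - s) u) V-s⊆reached
    ... | no none = ⊥-elim (<⇒≱ n<k*k (begin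
          k * k                  ≤⟨ *-monoˡ-≤ k k≤∣S∣ ⟩
          ∣ S ∣ * k              ≤⟨ ∣S∣*k≤∣⋃-over∣ S unreached S-disjoint k≤∣unreached∣ ⟩
          ∣ ⋃-over S unreached ∣ ≤⟨ ∣p∣≤n (⋃-over S unreached) ⟩
          n                      ∎))
      where
      open ≤-Reasoning
      S = N G u ∩ V ─ Y
      k≤∣S∣ : k ≤ ∣ S ∣
      k≤∣S∣ = +-cancelʳ-≤ (∣ Y ∣) k (∣ S ∣) (≤-trans (deg≥ u∈V) (∣p∣≤∣p─q∣+∣q∣ (N G u ∩ V) Y))
      S-disjoint : PairwiseDisjointOn S unreached
      S-disjoint s∈ t∈ = unreached-disjoint (p─q⊆p _ Y s∈) (p─q⊆p _ Y t∈)
      k≤∣unreached∣ : ∀ {s} → s ∈ S → k ≤ ∣ unreached s ∣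
      k≤∣unreached∣ s∈S with p⊈q⇒Nonempty[p─q] (λ V-s⊆reached → none (_ , s∈S , V-s⊆reached))
      ... | c , c∈ = ≤-trans (m≤m+n k ∣ Y ∣) (≤-trans (deg≥ (unreached⊆V c∈)) (degree≤∣outside∣ reached-closed c∈))

  deletable-neighbours : ∀ m {V u Y k} → ConnectedOn G V → u ∈ V → n < k * k →
    (∀ {v} → v ∈ V → k + (m + ∣ Y ∣) ≤ ∣ N G v ∩ V ∣) →
    Σ (Subset n) λ X → X ⊆ N G u ∩ V ─ Y × ∣ X ∣ ≡ m × ConnectedOn G (V ─ X)
  deletable-neighbours zero {V} V-connected _ _ _ =
    ⊥ , ⊥⊆ , ∣⊥∣≡0 n , subst (ConnectedOn G) (sym (p─⊥≡p V)) V-connected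
  deletable-neighbours (suc m) {V} {u} {Y} {k} V-connected u∈V n<k*k deg≥
    with deletable-neighbour V-connected u∈V n<k*k (λ v∈V → ≤-trans (+-monoʳ-≤ k (m≤n+m ∣ Y ∣ (suc m))) (deg≥ v∈V))
  ... | x , x∈ , V-x-connected with deletable-neighbours m {k = k} V-x-connected u∈V-x n<k*k deg≥′
    where
    u∈V-x : u ∈ V - x
    u∈V-x = x∈p∧x≢y⇒x∈p-y u∈V (adj⇒≢ (∈N⇒adj (proj₁ (x∈p∩q⁻ (N G u) V (p─q⊆p _ Y x∈)))))
    deg≥′ : ∀ {v} → v ∈ V - x → k + (m + ∣ Y ∣) ≤ ∣ N G v ∩ (V - x) ∣
    deg≥′ {v} v∈ = s≤s⁻¹ (begin
      suc (k + (m + ∣ Y ∣)) ≡⟨ +-suc k (m + ∣ Y ∣) ⟨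
      k + (suc m + ∣ Y ∣)   ≤⟨ deg≥ (p─q⊆p V ⁅ x ⁆ v∈) ⟩
      ∣ N G v ∩ V ∣         ≤⟨ ∣p∩q∣≤1+∣p∩[q-x]∣ (N G v) V x ⟩
      suc ∣ N G v ∩ (V - x) ∣ ∎)
      where open ≤-Reasoning
  ... | X , X⊆ , ∣X∣≡m , V-x-X-connected =
    ⁅ x ⁆ ∪ X , ⁅x⁆∪X⊆ , trans (x∉p⇒∣⁅x⁆∪p∣≡1+∣p∣ x∉X) (cong suc ∣X∣≡m) ,
    subst (ConnectedOn G) (p─q─r≡p─q∪r V ⁅ x ⁆ X) V-x-X-connected
    where
    X-member : ∀ {y} → y ∈ X → y ∈ N G u ∩ V ─ Y × y ≢ x
    X-member y∈X with x∈p─q⁻ (X⊆ y∈X)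
    ... | y∈N∩[V-x] , y∉Y with x∈p∩q⁻ (N G u) (V - x) y∈N∩[V-x]
    ...   | y∈N , y∈V-x with x∈p─q⁻ y∈V-x
    ...     | y∈V , y∉⁅x⁆ = x∈p∧x∉q⇒x∈p─q (x∈p∩q⁺ (y∈N , y∈V)) y∉Y , x∉⁅y⁆⇒x≢y y∉⁅x⁆
    x∉X : x ∉ X
    x∉X x∈X = proj₂ (X-member x∈X) refl
    ⁅x⁆∪X⊆ : ⁅ x ⁆ ∪ X ⊆ N G u ∩ V ─ Y
    ⁅x⁆∪X⊆ y∈ with x∈p∪q⁻ ⁅ x ⁆ X y∈
    ... | inj₁ y∈⁅x⁆ rewrite x∈⁅y⁆⇒x≡y x y∈⁅x⁆ = x∈
    ... | inj₂ y∈X = proj₁ (X-member y∈X)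

  deletable-neighbours-of-graph : ∀ m {u Y k} → Connected G → n < k * k →
    (∀ v → k + (m + ∣ Y ∣) ≤ deg G v) →
    Σ (Subset n) λ X → X ⊆ N G u ─ Y × ∣ X ∣ ≡ m × ConnectedMinus G X
  deletable-neighbours-of-graph m {u} {Y} {k} connected n<k*k deg≥
    with deletable-neighbours m {⊤} {u} {Y} {k} connected ∈⊤ n<k*k deg≥∩⊤
    where
    deg≥∩⊤ : ∀ {v} → v ∈ ⊤ → k + (m + ∣ Y ∣) ≤ ∣ N G v ∩ ⊤ ∣
    deg≥∩⊤ {v} _ = subst (λ A → k + (m + ∣ Y ∣) ≤ ∣ A ∣) (sym (∩-identityʳ (N G v))) (deg≥ v)
  ... | X , X⊆ , ∣X∣≡m , ⊤─X-connected =
    X , subst (λ A → X ⊆ A ─ Y) (∩-identityʳ (N G u)) X⊆ , ∣X∣≡m ,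
    subst (ConnectedOn G) (⊤─p≡∁p X) ⊤─X-connected

minimiser : ∀ {n} (f : Fin (suc n) → ℕ) → ∃ λ w → ∀ v → f w ≤ f v
minimiser {n} f =
  argmin f zero (allFin (suc n)) ,
  λ v → All-lookup (f[argmin]≤f[xs] {f = f} zero (allFin (suc n))) (∈-allFin v)

n<4n : ∀ n → suc n < 4 * suc n
n<4n n = subst (suc n <_) (*-comm (suc n) 4) (m<m*n (suc n) 4 (s≤s (s≤s z≤n)))

-- Only n < (δ - c)² is needed, which is weaker than 4n ≤ (δ - c)².
excess-degree : ∀ {n c} (G : Graph (suc n)) → MinDegAtLeastTwoSqrtPlus G c →
                ∃ λ k → suc n < k * k × (∀ v → k + c ≤ deg G v)
excess-degree {n} {c} G δ≥ = deg G w ∸ c , <-≤-trans (n<4n n) (proj₂ (δ≥ w)) , w+c≤deg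
  where
  w = proj₁ (minimiser (deg G))
  w+c≤deg : ∀ v → deg G w ∸ c + c ≤ deg G v
  w+c≤deg v = subst (_≤ deg G v) (sym (m∸n+n≡m (proj₁ (δ≥ w)))) (proj₂ (minimiser (deg G)) v)

lemma2p2 : (m n : ℕ) (G : Graph n) → Connected G → (u : Fin n) (Y : Subset n) → u ∉ Y →
    MinDegAtLeastTwoSqrtPlus G (m + ∣ Y ∣) →
    Σ (Subset n) (λ X → (X ⊆ (N G u ─ Y)) × (∣ X ∣ ≡ m) × ConnectedMinus G X)
lemma2p2 m zero G _ () _ _ _
lemma2p2 m (suc n) G connected u Y _ δ≥ =
  let k , n<k*k , deg≥ = excess-degree G δ≥
  in  deletable-neighbours-of-graph G m {u} {Y} {k} connected n<k*k deg≥
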